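{- Let $(G,k,i,j)$ be a yes-instance of Biclique-Free Vertex Deletion. Let $\mathcal{X}\subseteq\mathcal{S}_G$ be a nonempty collection of smaller sides of bicliques and let $X=\bigcup_{X'\in\mathcal{X}}X'$. Suppose that $V'$ is a solution of $(G,k,i,j)$ with $V'\cap X=\emptyset$. Then there exists a vertex $v\in V'$ which has at least $|X|/k$ neighbors in $X$.
   Context: Biclique-Free Vertex Deletion: given an undirected graph $G$ and integers $i,j,k$ with $i\le j$, decide whether there is a set $V'\subseteq V(G)$ (a solution) with $|V'|\le k$ such that $G-V'$ contains no $K_{i,j}$ as a (not necessarily induced) subgraph. A biclique is a pair $(S,T)$ of disjoint vertex sets with $|S|=i$, $|T|=j$ and $st\in E(G)$ for all $s\in S,t\in T$; $S$ is its smaller side. $\mathcal{S}_G$ is the collection of smaller sides of all bicliques of $G$. -}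

module Defs where

open import Data.Nat using (ℕ; _≤_)
open import Data.Bool using (Bool; true; false)
open import Data.Fin using (Fin)
open import Data.Fin.Subset using (Subset; _∈_; _∉_; _⊆_; ∣_∣; _∩_; ∁; ⋃)
open import Data.List using (List)
open import Data.List.Relation.Unary.All using (All)
open import Data.Vec using (tabulate)
open import Data.Product using (Σ; _×_; ∃)
open import Relation.Binary.PropositionalEquality using (_≡_)
open import Relation.Nullary using (¬_)

record Graph (n : ℕ) : Set where
  field
    adj   : Fin n → Fin n → Bool
    sym   : ∀ u v → adj u v ≡ adj v u
    irref : ∀ v → adj v v ≡ false
open Graph public

IsBiclique : ∀ {n} → Graph n → ℕ → ℕ → Subset n → Subset n → Set
IsBiclique G i j S T =
  (∀ v → v ∈ S → v ∉ T) ×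
  ∣ S ∣ ≡ i × ∣ T ∣ ≡ j ×
  (∀ s t → s ∈ S → t ∈ T → adj G s t ≡ true)

SmallerSide : ∀ {n} → Graph n → ℕ → ℕ → Subset n → Set
SmallerSide G i j S = ∃ λ T → IsBiclique G i j S T

-- G - V' contains a K_{i,j} as a subgraph: a biclique of G avoiding V'.
HasBicliqueAvoiding : ∀ {n} → Graph n → ℕ → ℕ → Subset n → Set
HasBicliqueAvoiding G i j V' =
  Σ (Subset n) λ S → Σ (Subset n) λ T →
    IsBiclique G i j S T × S ⊆ ∁ V' × T ⊆ ∁ V'
  where n = _

IsSolution : ∀ {n} → Graph n → ℕ → ℕ → ℕ → Subset n → Set
IsSolution G k i j V' = ∣ V' ∣ ≤ k × ¬ HasBicliqueAvoiding G i j V'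

YesInstance : ∀ {n} → Graph n → ℕ → ℕ → ℕ → Set
YesInstance {n} G k i j = ∃ λ (V' : Subset n) → IsSolution G k i j V'

N : ∀ {n} → Graph n → Fin n → Subset n
N G v = tabulate (adj G v)

-- Every smaller side S ∈ 𝒳 has a larger side T, and T must meet the
-- solution V' (otherwise the biclique survives in G - V'); any t ∈ T ∩ V'
-- is adjacent to all of S. Hence the neighbourhoods of the at most k
-- vertices of V' cover X, and the largest of them has at least |X|/k
-- elements of X.
module Submission where

open import Defs
open import Data.Nat using (ℕ; _≤_; _*_; _+_; z≤n; s≤s)
open import Data.Nat.Properties
open import Data.Fin using (Fin; zero; suc)
open import Data.Fin.Subset using (Subset; _∈_; _∉_; _⊆_; ∣_∣; _∩_; ∁; ⋃; ⊥; inside; outside; Nonempty; Empty)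
open import Data.Fin.Subset.Properties
open import Data.List using (List; []; _∷_)
open import Data.List.Relation.Unary.All using (All; _∷_)
open import Data.Vec using ([]; _∷_; here; there; tabulate)
open import Data.Vec.Properties using (lookup∘tabulate; lookup⇒[]=)
open import Data.Product using (_×_; ∃; _,_)
open import Data.Bool using (true)
open import Data.Sum using (inj₁; inj₂)
open import Relation.Binary.PropositionalEquality as ≡ using (_≡_; refl; trans)
open import Relation.Nullary using (¬_; yes; no; contradiction)

∣p∣≤∣p∩∁q∣+∣q∣ : ∀ {n} (p q : Subset n) → ∣ p ∣ ≤ ∣ p ∩ ∁ q ∣ + ∣ q ∣
∣p∣≤∣p∩∁q∣+∣q∣ []            []            = z≤n
∣p∣≤∣p∩∁q∣+∣q∣ (outside ∷ p) (outside ∷ q) = ∣p∣≤∣p∩∁q∣+∣q∣ p q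
∣p∣≤∣p∩∁q∣+∣q∣ (outside ∷ p) (inside ∷ q)  =
  ≤-trans (∣p∣≤∣p∩∁q∣+∣q∣ p q) (+-monoʳ-≤ _ (n≤1+n _))
∣p∣≤∣p∩∁q∣+∣q∣ (inside ∷ p)  (outside ∷ q) = s≤s (∣p∣≤∣p∩∁q∣+∣q∣ p q)
∣p∣≤∣p∩∁q∣+∣q∣ (inside ∷ p)  (inside ∷ q)  =
  ≤-trans (s≤s (∣p∣≤∣p∩∁q∣+∣q∣ p q)) (≤-reflexive (≡.sym (+-suc _ _)))

Empty[p∩q]⇒p⊆∁q : ∀ {n} {p q : Subset n} → Empty (p ∩ q) → p ⊆ ∁ q
Empty[p∩q]⇒p⊆∁q {q = q} p∩q-empty {x} x∈p with x ∈? q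
... | yes x∈q = contradiction (x , x∈p∩q⁺ (x∈p , x∈q)) p∩q-empty
... | no  x∉q = x∉p⇒x∈∁p x∉q

union-bound : ∀ {m n} (A : Subset m) (F : Fin m → Subset n) {M : ℕ} (X : Subset n) →
  (∀ v → v ∈ A → ∣ F v ∣ ≤ M) → (∀ {x} → x ∈ X → ∃ λ v → v ∈ A × x ∈ F v) →
  ∣ X ∣ ≤ ∣ A ∣ * M
union-bound {n = n} [] F X bounded covers =
  ≤-trans (p⊆q⇒∣p∣≤∣q∣ X⊆⊥) (≤-reflexive (∣⊥∣≡0 n))
  where
  X⊆⊥ : X ⊆ ⊥
  X⊆⊥ x∈X with covers x∈X
  ... | _ , () , _
union-bound (outside ∷ A) F X bounded covers =
  union-bound A (λ v → F (suc v)) X (λ v v∈A → bounded (suc v) (there v∈A)) covers′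
  where
  covers′ : ∀ {x} → x ∈ X → ∃ λ v → v ∈ A × x ∈ F (suc v)
  covers′ x∈X with covers x∈X
  ... | suc v , there v∈A , x∈Fv = v , v∈A , x∈Fv
union-bound (inside ∷ A) F {M} X bounded covers = begin
  ∣ X ∣                         ≤⟨ ∣p∣≤∣p∩∁q∣+∣q∣ X (F zero) ⟩
  ∣ X ∩ ∁ (F zero) ∣ + ∣ F zero ∣ ≤⟨ +-mono-≤ rest (bounded zero here) ⟩
  ∣ A ∣ * M + M                 ≡⟨ +-comm (∣ A ∣ * M) M ⟩
  M + ∣ A ∣ * M                 ∎
  where
  open ≤-Reasoning
  covers′ : ∀ {x} → x ∈ X ∩ ∁ (F zero) → ∃ λ v → v ∈ A × x ∈ F (suc v)
  covers′ x∈ with x∈p∩q⁻ X _ x∈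
  ... | x∈X , x∉F₀ with covers x∈X
  ... | zero  , _          , x∈F₀ = contradiction x∈F₀ (x∈∁p⇒x∉p x∉F₀)
  ... | suc v , there v∈A , x∈Fv = v , v∈A , x∈Fv
  rest : ∣ X ∩ ∁ (F zero) ∣ ≤ ∣ A ∣ * M
  rest = union-bound A (λ v → F (suc v)) _ (λ v v∈A → bounded (suc v) (there v∈A)) covers′

argmax : ∀ {m} (A : Subset m) (f : Fin m → ℕ) → Nonempty A →
  ∃ λ v → v ∈ A × (∀ w → w ∈ A → f w ≤ f v)
argmax (outside ∷ A) f (suc x , there x∈A) with argmax A (λ w → f (suc w)) (x , x∈A)
... | v , v∈A , max = suc v , there v∈A , λ { (suc w) (there w∈A) → max w w∈A }
argmax (inside ∷ A) f _ with nonempty? A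
... | no A-empty = zero , here , λ
  { zero _ → ≤-refl
  ; (suc w) (there w∈A) → contradiction (w , w∈A) A-empty }
... | yes A-nonempty with argmax A (λ w → f (suc w)) A-nonempty
... | v , v∈A , max with ≤-total (f zero) (f (suc v))
... | inj₁ f₀≤fv = suc v , there v∈A , λ
  { zero _ → f₀≤fv
  ; (suc w) (there w∈A) → max w w∈A }
... | inj₂ fv≤f₀ = zero , here , λ
  { zero _ → ≤-refl
  ; (suc w) (there w∈A) → ≤-trans (max w w∈A) fv≤f₀ }

adj⇒∈N : ∀ {n} (G : Graph n) {u v : Fin n} → adj G u v ≡ true → v ∈ N G u
adj⇒∈N G {u} {v} uv = lookup⇒[]= v (tabulate (adj G u)) (trans (lookup∘tabulate (adj G u) v) uv)

smaller-side⊆N : ∀ {n} (G : Graph n) {i j : ℕ} {S T : Subset n} {t : Fin n} →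
  IsBiclique G i j S T → t ∈ T → S ⊆ N G t
smaller-side⊆N G {t = t} (_ , _ , _ , complete) t∈T {s} s∈S =
  adj⇒∈N G (trans (Graph.sym G t s) (complete s t s∈S t∈T))

solution-meets-larger-side : ∀ {n} {G : Graph n} {i j : ℕ} {V' S T : Subset n} →
  ¬ HasBicliqueAvoiding G i j V' → IsBiclique G i j S T → S ⊆ ∁ V' → Nonempty (T ∩ V')
solution-meets-larger-side {V' = V'} {S} {T} no-biclique biclique S⊆∁V' with nonempty? (T ∩ V')
... | yes T∩V'-nonempty = T∩V'-nonempty
... | no  T∩V'-empty   =
  contradiction (S , T , biclique , (λ {_} → S⊆∁V') , (λ {_} → Empty[p∩q]⇒p⊆∁q T∩V'-empty)) no-biclique

smaller-side-dominated : ∀ {n} {G : Graph n} {i j : ℕ} {V' S : Subset n} →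
  ¬ HasBicliqueAvoiding G i j V' → SmallerSide G i j S → S ⊆ ∁ V' →
  ∃ λ v → v ∈ V' × S ⊆ N G v
smaller-side-dominated {G = G} {i} {j} {V'} no-biclique (T , biclique) S⊆∁V'
  with solution-meets-larger-side {G = G} {i} {j} no-biclique biclique S⊆∁V'
... | t , t∈T∩V' with x∈p∩q⁻ T V' t∈T∩V'
... | t∈T , t∈V' = t , t∈V' , smaller-side⊆N G biclique t∈T

⋃-smaller-sides-dominated : ∀ {n} {G : Graph n} {i j : ℕ} {V' : Subset n} {𝒳 : List (Subset n)} →
  ¬ HasBicliqueAvoiding G i j V' → All (SmallerSide G i j) 𝒳 → ⋃ 𝒳 ⊆ ∁ V' →
  ∀ {x} → x ∈ ⋃ 𝒳 → ∃ λ v → v ∈ V' × x ∈ N G v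
⋃-smaller-sides-dominated {𝒳 = []} _ _ _ x∈⊥ = contradiction x∈⊥ ∉⊥
⋃-smaller-sides-dominated {G = G} {i} {j} {𝒳 = S ∷ 𝒳} no-biclique (side ∷ sides) ⋃⊆∁V' x∈
  with x∈p∪q⁻ S (⋃ 𝒳) x∈
... | inj₁ x∈S
  with smaller-side-dominated {G = G} {i} {j} no-biclique side (λ s∈S → ⋃⊆∁V' (p⊆p∪q (⋃ 𝒳) s∈S))
...   | v , v∈V' , S⊆Nv = v , v∈V' , S⊆Nv x∈S
⋃-smaller-sides-dominated {G = G} {i} {j} {𝒳 = S ∷ 𝒳} no-biclique (side ∷ sides) ⋃⊆∁V' x∈
    | inj₂ x∈⋃𝒳 =
  ⋃-smaller-sides-dominated {G = G} {i} {j} no-biclique sides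
    (λ y∈⋃𝒳 → ⋃⊆∁V' (q⊆p∪q S (⋃ 𝒳) y∈⋃𝒳)) x∈⋃𝒳

lemma5 : ∀ {n} (G : Graph n) (k i j : ℕ) → i ≤ j → YesInstance G k i j →
    (𝒳 : List (Subset n)) → ¬ (𝒳 ≡ []) → All (SmallerSide G i j) 𝒳 →
    (V' : Subset n) → IsSolution G k i j V' → (∀ v → v ∈ V' → v ∉ ⋃ 𝒳) →
    ∃ λ v → v ∈ V' × ∣ ⋃ 𝒳 ∣ ≤ k * ∣ N G v ∩ ⋃ 𝒳 ∣
lemma5 G k i j _ _ [] 𝒳≢[] _ _ _ _ = contradiction refl 𝒳≢[]
lemma5 G k i j _ _ 𝒳@(_ ∷ _) _ sides@(side ∷ _) V' (∣V'∣≤k , no-biclique) V'∩X-empty =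
  let v , v∈V' , v-busiest = argmax V' (λ w → ∣ N G w ∩ X ∣) V'-nonempty in
  v , v∈V' , (begin
    ∣ X ∣                 ≤⟨ union-bound V' (λ w → N G w ∩ X) X v-busiest covers ⟩
    ∣ V' ∣ * ∣ N G v ∩ X ∣ ≤⟨ *-monoˡ-≤ _ ∣V'∣≤k ⟩
    k * ∣ N G v ∩ X ∣     ∎)
  where
  open ≤-Reasoning
  X = ⋃ 𝒳
  X⊆∁V' : X ⊆ ∁ V'
  X⊆∁V' x∈X = x∉p⇒x∈∁p (λ x∈V' → V'∩X-empty _ x∈V' x∈X)
  covers : ∀ {x} → x ∈ X → ∃ λ v → v ∈ V' × x ∈ N G v ∩ X
  covers x∈X with ⋃-smaller-sides-dominated {G = G} {i} {j} no-biclique sides X⊆∁V' x∈X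
  ... | v , v∈V' , x∈Nv = v , v∈V' , x∈p∩q⁺ (x∈Nv , x∈X)
  V'-nonempty : Nonempty V'
  V'-nonempty
    with smaller-side-dominated {G = G} {i} {j} no-biclique side (λ s∈S → X⊆∁V' (p⊆p∪q _ s∈S))
  ... | v , v∈V' , _ = v , v∈V'
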